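{- Let $G$ be the group whose elements are the triples $(i,j,s)\in\mathbb{Z}^3$, written as formal monomials $x^iy^jz^s$, with multiplication $$x^iy^jz^s\cdot x^{i'}y^{j'}z^{s'}=x^{i+i'}y^{j+j'}z^{s+s'+ij'},$$ and let $\mathbb{Z}[G]$ be its integral group ring (finite formal $\mathbb{Z}$-linear combinations $\sum a(i,j,s)\,x^iy^jz^s$, with multiplication extended bilinearly from that of $G$). In $\mathbb{Z}[G]$ let $x=x^1y^0z^0$, $x^{ -1}=x^{ -1}y^0z^0$, $y=x^0y^1z^0$, $y^{ -1}=x^0y^{ -1}z^0$, and put $\mathfrak{w}=x+x^{ -1}+y+y^{ -1}$. For integers $n\ge 0$ and $p,q,s$, let $w_n(p,q,s)$ be the number of walks of length $n$ in the square lattice which begin at the origin, end at $(p,q)$, and have area $s$. Then $w_n(p,q,s)$ equals the coefficient of $x^py^qz^s$ in $\mathfrak{w}^n$, the power being computed in $\mathbb{Z}[G]$.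
   Context: A walk of length $n$ in the square lattice is a sequence of points $[(x_0,y_0),(x_1,y_1),\ldots,(x_n,y_n)]$ of $\mathbb{Z}^2$ such that for each $0\le i\le n-1$ one has $\{|x_{i+1}-x_i|,|y_{i+1}-y_i|\}=\{0,1\}$. The area of such a walk $Q$ (not necessarily closed) is defined as $$S(Q)=\sum_{i=0}^{n-1} x_i(y_{i+1}-y_i)+x_0(y_0-y_n);$$ for a walk beginning at the origin this is $\sum_{i=0}^{n-1} x_i(y_{i+1}-y_i)$. Note that in $\mathbb{Z}[G]$ the monomial $x^iy^jz^s$ denotes the group element $(i,j,s)$ and is in general not the product $x^i\cdot y^j\cdot z^s$. -}

module Defs where

open import Data.Nat using (ℕ; zero; suc)
open import Data.Integer as ℤ using (ℤ; +_; -_; _+_; _*_; 0ℤ; 1ℤ)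
open import Data.Product using (_×_; _,_)
open import Data.List using (List; []; _∷_; _++_; map; concatMap; length; filterᵇ; sum)
open import Data.Vec using (Vec; []; _∷_)
open import Data.Bool using (Bool; _∧_; if_then_else_)
open import Relation.Nullary.Decidable using (⌊_⌋)

G : Set
G = ℤ × ℤ × ℤ

_∙_ : G → G → G
(i , j , s) ∙ (i′ , j′ , s′) = (i + i′ , j + j′ , s + s′ + i * j′)

e : G
e = (0ℤ , 0ℤ , 0ℤ)

_≡ᵇG_ : G → G → Bool
(i , j , s) ≡ᵇG (i′ , j′ , s′) = ⌊ i ℤ.≟ i′ ⌋ ∧ ⌊ j ℤ.≟ j′ ⌋ ∧ ⌊ s ℤ.≟ s′ ⌋

-- The integral group ring ℤ[G]: finite formal ℤ-linear combinations of
-- elements of G, represented by a finite list of terms (a , g) meaning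
-- Σ a·g.  Two representations denote the same element iff they have the
-- same coefficient function `coeff`.

ℤ[G] : Set
ℤ[G] = List (ℤ × G)

coeff : ℤ[G] → G → ℤ
coeff []            g = 0ℤ
coeff ((a , h) ∷ u) g = (if h ≡ᵇG g then a else 0ℤ) + coeff u g

mono : G → ℤ[G]
mono g = (1ℤ , g) ∷ []

one : ℤ[G]
one = mono e

_⊕_ : ℤ[G] → ℤ[G] → ℤ[G]
u ⊕ v = u ++ v

_⊗_ : ℤ[G] → ℤ[G] → ℤ[G]
u ⊗ v = concatMap (λ { (a , g) → map (λ { (b , h) → (a * b , g ∙ h) }) v }) u

_^_ : ℤ[G] → ℕ → ℤ[G]
u ^ zero  = one
u ^ suc n = u ⊗ (u ^ n)

𝔴 : ℤ[G]
𝔴 = mono (1ℤ , 0ℤ , 0ℤ) ⊕ (mono (- 1ℤ , 0ℤ , 0ℤ) ⊕ (mono (0ℤ , 1ℤ , 0ℤ) ⊕ mono (0ℤ , - 1ℤ , 0ℤ)))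

-- Walks in the square lattice starting at the origin.  Such a walk of
-- length n, [(x₀,y₀),…,(xₙ,yₙ)] with (x₀,y₀) = (0,0), is determined by
-- its sequence of n unit steps; we represent it by that step sequence.

data Step : Set where
  E W N S : Step

dx : Step → ℤ
dx E = 1ℤ
dx W = - 1ℤ
dx N = 0ℤ
dx S = 0ℤ

dy : Step → ℤ
dy E = 0ℤ
dy W = 0ℤ
dy N = 1ℤ
dy S = - 1ℤ

allWalks : (n : ℕ) → List (Vec Step n)
allWalks zero    = [] ∷ []
allWalks (suc n) = concatMap (λ st → map (st ∷_) (allWalks n)) (E ∷ W ∷ N ∷ S ∷ [])

endFrom : ∀ {n} → ℤ × ℤ → Vec Step n → ℤ × ℤ
endFrom p             []        = p
endFrom (x , y)       (st ∷ w)  = endFrom (x + dx st , y + dy st) w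

-- Σ_{i} x_i (y_{i+1} - y_i) for the walk starting at (x , y)
areaFrom : ∀ {n} → ℤ × ℤ → Vec Step n → ℤ
areaFrom p       []       = 0ℤ
areaFrom (x , y) (st ∷ w) = x * dy st + areaFrom (x + dx st , y + dy st) w

origin : ℤ × ℤ
origin = (0ℤ , 0ℤ)

endpoint : ∀ {n} → Vec Step n → ℤ × ℤ
endpoint = endFrom origin

area : ∀ {n} → Vec Step n → ℤ
area = areaFrom origin

walkCount : ℕ → ℤ → ℤ → ℤ → ℕ
walkCount n p q s =
  length (filterᵇ (λ w → (endpoint w ≡ᵇG' (p , q)) ∧ ⌊ area w ℤ.≟ s ⌋) (allWalks n))
  where
    _≡ᵇG'_ : ℤ × ℤ → ℤ × ℤ → Bool
    (a , b) ≡ᵇG' (c , d) = ⌊ a ℤ.≟ c ⌋ ∧ ⌊ b ℤ.≟ d ⌋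

module Submission where

-- Read a walk, given by its step sequence st₁ … stₙ, as the
-- product of the group elements g(E) = x, g(W) = x⁻¹, g(N) = y, g(S) = y⁻¹;
-- call this product the monomial of the walk.  Two facts combine:
--
--  * Expanding 𝔴ⁿ = 𝔴·𝔴ⁿ⁻¹ by bilinearity without collecting terms produces,
--    literally as a list of terms, one term 1·(monomial of w) for every walk w
--    of length n, in the order in which `allWalks n` enumerates them.
--  * The monomial of a walk is x^p y^q z^s where (p , q) is its endpoint and
--    s its area.  This is proved by induction for walks started at an
--    arbitrary point (a , b): the endpoint is translated by (a , b) and the
--    area gains a·(total vertical displacement); the twist i·j' in the
--    multiplication of G is exactly this correction for each prefix step.
--
-- Finally the coefficient of g in a list of terms all having coefficient 1
-- is the number of terms whose monomial is g, which is exactly how the walk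
-- count w_n(p,q,s) is defined.

open import Defs
open import Data.Nat using (ℕ; zero; suc)
open import Data.Integer using (ℤ; +_; 0ℤ; 1ℤ; _+_; _*_; _≟_)
open import Data.Integer.Properties using (+-assoc; +-identityˡ; +-identityʳ; *-zeroˡ)
open import Data.Integer.Tactic.RingSolver using (solve-∀)
open import Data.Product using (_×_; _,_; proj₁; proj₂)
open import Data.List using (List; []; _∷_; map; concatMap; filterᵇ; length)
open import Data.List.Properties using (map-∘; map-concatMap; concatMap-cong)
open import Data.Vec using (Vec; []; _∷_)
open import Data.Bool using (Bool; true; false; _∧_)
open import Data.Bool.Properties using (∧-assoc)
open import Relation.Nullary.Decidable using (⌊_⌋)
open import Relation.Binary.PropositionalEquality
  using (_≡_; refl; sym; trans; cong; cong₂; module ≡-Reasoning)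

stepMonomial : Step → G
stepMonomial st = (dx st , dy st , 0ℤ)

walkMonomial : ∀ {n} → Vec Step n → G
walkMonomial []       = e
walkMonomial (st ∷ w) = stepMonomial st ∙ walkMonomial w

xExp yExp zExp : G → ℤ
xExp (i , j , s) = i
yExp (i , j , s) = j
zExp (i , j , s) = s

endFrom-monomial : ∀ {n} (a b : ℤ) (w : Vec Step n) →
  endFrom (a , b) w ≡ (a + xExp (walkMonomial w) , b + yExp (walkMonomial w))
endFrom-monomial a b [] = sym (cong₂ _,_ (+-identityʳ a) (+-identityʳ b))
endFrom-monomial a b (st ∷ w) =
  trans (endFrom-monomial (a + dx st) (b + dy st) w)
        (cong₂ _,_ (+-assoc a (dx st) (xExp (walkMonomial w)))
                   (+-assoc b (dy st) (yExp (walkMonomial w))))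

-- In the inductive step
-- the twist term i·j of the product g(st)·(monomial of the rest) accounts for
-- the horizontal shift i of the starting point of the remaining walk.
areaFrom-monomial : ∀ {n} (a b : ℤ) (w : Vec Step n) →
  areaFrom (a , b) w ≡ a * yExp (walkMonomial w) + zExp (walkMonomial w)
areaFrom-monomial a b [] = shift-zero a
  where
  shift-zero : ∀ (c : ℤ) → 0ℤ ≡ c * 0ℤ + 0ℤ
  shift-zero = solve-∀
areaFrom-monomial a b (st ∷ w) = begin
  a * dy st + areaFrom (a + dx st , b + dy st) w
    ≡⟨ cong (λ t → a * dy st + t) (areaFrom-monomial (a + dx st) (b + dy st) w) ⟩
  a * dy st + ((a + dx st) * j + s)
    ≡⟨ regroup a (dx st) (dy st) j s ⟩
  a * (dy st + j) + (0ℤ + s + dx st * j)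
    ∎
  where
  open ≡-Reasoning
  j s : ℤ
  j = yExp (walkMonomial w)
  s = zExp (walkMonomial w)
  regroup : ∀ (a i d j s : ℤ) →
    a * d + ((a + i) * j + s) ≡ a * (d + j) + (0ℤ + s + i * j)
  regroup = solve-∀

walkMonomial-endpoint-area : ∀ {n} (w : Vec Step n) →
  walkMonomial w ≡ (proj₁ (endpoint w) , proj₂ (endpoint w) , area w)
walkMonomial-endpoint-area w
  rewrite endFrom-monomial 0ℤ 0ℤ w | areaFrom-monomial 0ℤ 0ℤ w
        | +-identityˡ (xExp (walkMonomial w)) | +-identityˡ (yExp (walkMonomial w))
        | *-zeroˡ (yExp (walkMonomial w)) | +-identityˡ (zExp (walkMonomial w)) = refl

walkTerm : ∀ {n} → Vec Step n → ℤ × G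
walkTerm w = (1ℤ , walkMonomial w)

𝔴-⊗ : ∀ (u : ℤ[G]) →
  𝔴 ⊗ u ≡ concatMap (λ st → map (λ { (b , h) → (1ℤ * b , stepMonomial st ∙ h) }) u)
                    (E ∷ W ∷ N ∷ S ∷ [])
𝔴-⊗ u = refl

𝔴^n-expansion : ∀ n → 𝔴 ^ n ≡ map walkTerm (allWalks n)
𝔴^n-expansion zero    = refl
𝔴^n-expansion (suc n) = begin
  𝔴 ⊗ (𝔴 ^ n)
    ≡⟨ cong (𝔴 ⊗_) (𝔴^n-expansion n) ⟩
  𝔴 ⊗ map walkTerm L
    ≡⟨ 𝔴-⊗ (map walkTerm L) ⟩
  concatMap (λ st → map (λ { (b , h) → (1ℤ * b , stepMonomial st ∙ h) }) (map walkTerm L)) steps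
    ≡⟨ concatMap-cong (λ st → sym (prepend st)) steps ⟩
  concatMap (λ st → map walkTerm (map (st ∷_) L)) steps
    ≡⟨ sym (map-concatMap walkTerm (λ st → map (st ∷_) L) steps) ⟩
  map walkTerm (allWalks (suc n))
    ∎
  where
  open ≡-Reasoning
  L = allWalks n
  steps = E ∷ W ∷ N ∷ S ∷ []
  prepend : ∀ st →
    map walkTerm (map (st ∷_) L) ≡
    map (λ { (b , h) → (1ℤ * b , stepMonomial st ∙ h) }) (map walkTerm L)
  prepend st = trans (sym (map-∘ L)) (map-∘ L)

coeff-unitTerms : ∀ {A : Set} (f : A → G) (g : G) (xs : List A) →
  coeff (map (λ a → (1ℤ , f a)) xs) g ≡ + length (filterᵇ (λ a → f a ≡ᵇG g) xs)
coeff-unitTerms f g []       = refl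
coeff-unitTerms f g (a ∷ xs) with f a ≡ᵇG g
... | true  = cong (λ c → 1ℤ + c) (coeff-unitTerms f g xs)
... | false = trans (+-identityˡ _) (coeff-unitTerms f g xs)

filterᵇ-cong : ∀ {A : Set} {P Q : A → Bool} → (∀ a → P a ≡ Q a) →
  (xs : List A) → filterᵇ P xs ≡ filterᵇ Q xs
filterᵇ-cong P≗Q [] = refl
filterᵇ-cong {P = P} {Q} P≗Q (a ∷ xs) with P a | Q a | P≗Q a
... | true  | .true  | refl = cong (a ∷_) (filterᵇ-cong P≗Q xs)
... | false | .false | refl = filterᵇ-cong P≗Q xs

theorem1 : (n : ℕ) (p q s : ℤ) → + (walkCount n p q s) ≡ coeff (𝔴 ^ n) (p , q , s)
theorem1 n p q s = sym (begin
  coeff (𝔴 ^ n) (p , q , s)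
    ≡⟨ cong (λ u → coeff u (p , q , s)) (𝔴^n-expansion n) ⟩
  coeff (map walkTerm (allWalks n)) (p , q , s)
    ≡⟨ coeff-unitTerms walkMonomial (p , q , s) (allWalks n) ⟩
  + length (filterᵇ (λ w → walkMonomial w ≡ᵇG (p , q , s)) (allWalks n))
    ≡⟨ cong (λ ws → + length ws) (filterᵇ-cong same-test (allWalks n)) ⟩
  + walkCount n p q s
    ∎)
  where
  open ≡-Reasoning
  same-test : ∀ (w : Vec Step n) → (walkMonomial w ≡ᵇG (p , q , s)) ≡
    ((⌊ proj₁ (endpoint w) ≟ p ⌋ ∧ ⌊ proj₂ (endpoint w) ≟ q ⌋) ∧ ⌊ area w ≟ s ⌋)
  same-test w rewrite walkMonomial-endpoint-area w =
    sym (∧-assoc ⌊ proj₁ (endpoint w) ≟ p ⌋ ⌊ proj₂ (endpoint w) ≟ q ⌋ ⌊ area w ≟ s ⌋)
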